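{- Let $X$ be a finite set and let $\mathcal{D}\subseteq\mathcal{R}(X)$ be a maximal single-crossing domain, with its maximal chain $R_1,\dots,R_m$ and switching pairs $\{x_j,y_j\}$ ($j=1,\dots,m-1$). Then $\mathcal{D}$ is a maximal Condorcet domain if and only if the maximal chain satisfies the pairwise concatenation condition: $\{x_j,y_j\}\cap\{x_{j+1},y_{j+1}\}\neq\emptyset$ for all $j=1,\dots,m-2$.
   Context: $\mathcal{R}(X)$ is the set of strict linear orders on $X$. A domain $\mathcal{D}\subseteq\mathcal{R}(X)$ has the single-crossing property (is a single-crossing domain) if its elements can be enumerated $R_1,\dots,R_m$ so that for every pair of distinct $x,y$ the sets $\{j:xR_jy\}$ and $\{j:yR_jx\}$ are intervals of consecutive indices; it is a maximal single-crossing domain if no single-crossing domain on $X$ properly contains it. For a maximal single-crossing domain such an enumeration is unique up to reversal and is called its maximal chain; consecutive orders $R_j,R_{j+1}$ differ exactly in the ranking of one pair of alternatives $\{x_j,y_j\}$ (adjacent in both), called the $j$-th switching pair. A Condorcet domain is a domain on which the majority relation of every profile (tuple of orders from the domain; $x$ above $y$ iff more than half of the voters rank $x$ above $y$) is acyclic; it is maximal if no Condorcet domain on $X$ properly contains it. -}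

module Defs where

open import Data.Nat using (ℕ; zero; suc; _+_; _*_; _<_)
open import Data.Fin as Fin using (Fin; toℕ) renaming (_≤_ to _≤ᶠ_)
open import Data.Fin.Properties using () renaming (_≟_ to _≟ᶠ_)
open import Data.Bool using (Bool; true; false; if_then_else_)
open import Data.List using (List; []; _∷_)
open import Data.List.Membership.Propositional using (_∈_)
open import Data.List.Relation.Unary.Unique.Propositional using (Unique)
open import Data.List.Relation.Unary.Any using (any?)
open import Data.Product using (Σ; ∃; _×_; _,_)
open import Data.Sum using (_⊎_)
open import Relation.Nullary using (¬_; does)
open import Relation.Binary.PropositionalEquality using (_≡_; _≢_)
open import Relation.Binary.Construct.Closure.Transitive using (TransClosure)
open import Function.Definitions using (Injective)

-- The finite set X is Fin n.  A strict linear order on Fin n is encoded by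
-- its ranking list (best first): a duplicate-free list containing every
-- alternative.
Order : ℕ → Set
Order n = List (Fin n)

IsLinOrd : ∀ {n} → Order n → Set
IsLinOrd {n} r = Unique r × (∀ (x : Fin n) → x ∈ r)

-- above r x y = true  iff  x R y  (x appears strictly before y in r)
above : ∀ {n} → Order n → Fin n → Fin n → Bool
above [] x y = false
above (z ∷ zs) x y =
  if does (z ≟ᶠ x) then does (any? (y ≟ᶠ_) zs)
  else (if does (z ≟ᶠ y) then false else above zs x y)

Domain : ℕ → Set₁
Domain n = Order n → Set

IsDomain : ∀ {n} → Domain n → Set
IsDomain D = ∀ r → D r → IsLinOrd r

_⊆D_ : ∀ {n} → Domain n → Domain n → Set
D ⊆D D' = ∀ r → D r → D' r

Interval : ∀ {m} → (Fin m → Set) → Set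
Interval {m} P = ∀ (i j k : Fin m) → i ≤ᶠ j → j ≤ᶠ k → P i → P k → P j

IsSCEnumeration : ∀ {n} → Domain n → (m : ℕ) → (Fin m → Order n) → Set
IsSCEnumeration {n} D m e =
  Injective _≡_ _≡_ e
  × (∀ i → D (e i))
  × (∀ r → D r → ∃ λ i → e i ≡ r)
  × (∀ (x y : Fin n) → x ≢ y →
       Interval (λ j → above (e j) x y ≡ true)
       × Interval (λ j → above (e j) y x ≡ true))

IsSingleCrossing : ∀ {n} → Domain n → Set
IsSingleCrossing {n} D =
  IsDomain D × ∃ λ m → Σ (Fin m → Order n) λ e → IsSCEnumeration D m e

IsMaximalSingleCrossing : ∀ {n} → Domain n → Set₁
IsMaximalSingleCrossing {n} D =
  IsSingleCrossing D
  × (∀ (D' : Domain n) → IsSingleCrossing D' → D ⊆D D' → D' ⊆D D)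

count : (k : ℕ) → (Fin k → Bool) → ℕ
count zero f = 0
count (suc k) f = (if f Fin.zero then 1 else 0) + count k (λ i → f (Fin.suc i))

Majority : ∀ {n} (k : ℕ) → (Fin k → Order n) → Fin n → Fin n → Set
Majority k P x y = k < 2 * count k (λ i → above (P i) x y)

Acyclic : ∀ {n} → (Fin n → Fin n → Set) → Set
Acyclic {n} M = ∀ (x : Fin n) → ¬ TransClosure M x x

IsCondorcet : ∀ {n} → Domain n → Set
IsCondorcet {n} D =
  IsDomain D
  × (∀ (k : ℕ) (P : Fin k → Order n) → (∀ i → D (P i)) → Acyclic (Majority k P))

IsMaximalCondorcet : ∀ {n} → Domain n → Set₁
IsMaximalCondorcet {n} D =
  IsCondorcet D × (∀ (D' : Domain n) → IsCondorcet D' → D ⊆D D' → D' ⊆D D)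

Switched : ∀ {n} → Order n → Order n → Fin n → Fin n → Set
Switched r r' x y = (above r x y ≡ true) × (above r' y x ≡ true)

InSwitchingPair : ∀ {n} → Order n → Order n → Fin n → Set
InSwitchingPair r r' z = ∃ λ u → Switched r r' z u ⊎ Switched r r' u z

PairwiseConcatenation : ∀ {n} (m : ℕ) → (Fin m → Order n) → Set
PairwiseConcatenation {n} m e =
  ∀ (i j k : Fin m) → toℕ j ≡ suc (toℕ i) → toℕ k ≡ suc (toℕ j) →
    ∃ λ (z : Fin n) → InSwitchingPair (e i) (e j) z × InSwitchingPair (e j) (e k) z

module Submission where

-- After basic facts on rankings (lists), adjacent transpositions, insertion
-- into sequences and majorities (median voter), we show that maximality of D
-- forces every step E j → E (j + 1) to exchange exactly one adjacent pair and
-- every pair to be exchanged exactly once (else a new order could be inserted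
-- into the chain); every single-crossing domain is Condorcet (median voter).
-- Sufficiency: an order r outside D follows or resists each step; resisting
-- one step and following the next gives, through their shared alternative, a
-- Condorcet cycle with E t and E (t + 2); so r follows the steps up to some s
-- and resists the rest, i.e. r = E s.  Necessity: steps exchanging disjoint
-- pairs commute, and D plus the order obtained by swapping them is still
-- Condorcet (majorities lie within the median order or within one of the four
-- orders of the commuting square), contradicting maximality.

open import Defs
open import Data.Nat using (ℕ; zero; suc; _+_; _*_; _<_; _≤_; pred; z≤n; s≤s; _<?_; _≤?_)
open import Data.Nat.Properties
open import Data.Fin as Fin using (Fin; toℕ; fromℕ<)
open import Data.Fin.Properties using (any?; toℕ-injective; toℕ<n; toℕ-fromℕ<; fromℕ<-toℕ) renaming (_≟_ to _≟ᶠ_)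
open import Data.Bool using (Bool; true; false; not)
open import Data.Bool.Properties using () renaming (_≟_ to _≟ᵇ_)
open import Data.List using ([]; _∷_; allFin)
open import Data.List.Properties using (≡-dec)
open import Data.List.Membership.Propositional using (_∈_)
open import Data.List.Membership.Propositional.Properties using (∈-allFin)
open import Data.List.Relation.Unary.Any using (here; there) renaming (any? to anyᴸ?)
open import Data.List.Relation.Unary.All using (All; _∷_) renaming (lookup to All-lookup)
open import Data.List.Relation.Unary.All.Properties using (All¬⇒¬Any)
open import Data.List.Relation.Unary.AllPairs using ([]; _∷_)
open import Data.List.Relation.Unary.Unique.Propositional using (Unique)
open import Data.List.Relation.Unary.Unique.Propositional.Properties using (allFin⁺)
open import Data.List.Relation.Binary.Permutation.Propositional using (_↭_; prep; swap; ↭-refl)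
open import Data.List.Relation.Binary.Permutation.Propositional.Properties using (All-resp-↭; ∈-resp-↭)
open import Data.Product using (Σ; ∃; _×_; _,_; proj₁; proj₂)
open import Data.Sum using (_⊎_; inj₁; inj₂)
open import Data.Empty using (⊥; ⊥-elim)
open import Relation.Nullary using (¬_; Dec; yes; no; does)
open import Relation.Nullary.Decidable using (_×-dec_; _⊎-dec_; ¬?; dec-true; decidable-stable; recompute)
open import Relation.Binary using (tri<; tri≈; tri>)
open import Relation.Binary.PropositionalEquality
open import Relation.Binary.Construct.Closure.Transitive using (TransClosure; [_]; _∷_)
open import Function.Bundles using (_⇔_; mk⇔; Equivalence)

variable
  n : ℕ
  x y z p q : Fin n
  r : Order n

data Above {n} : Order n → Fin n → Fin n → Set where
  top  : ∀ {x y r} → y ∈ r → Above (x ∷ r) x y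
  pass : ∀ {z x y r} → z ≢ x → z ≢ y → Above r x y → Above (z ∷ r) x y

Above⇒above : Above r x y → above r x y ≡ true
Above⇒above {x = x} {y} (top {r = zs} y∈zs) with x ≟ᶠ x
... | no x≢x = ⊥-elim (x≢x refl)
... | yes _ with anyᴸ? (y ≟ᶠ_) zs
...   | yes _ = refl
...   | no y∉zs = ⊥-elim (y∉zs y∈zs)
Above⇒above {x = x} {y} (pass {z = z} z≢x z≢y a) with z ≟ᶠ x
... | yes z≡x = ⊥-elim (z≢x z≡x)
... | no _ with z ≟ᶠ y
...   | yes z≡y = ⊥-elim (z≢y z≡y)
...   | no _ = Above⇒above a

above⇒Above : ∀ (r : Order n) x y → above r x y ≡ true → Above r x y
above⇒Above [] x y ()
above⇒Above (z ∷ zs) x y eq with z ≟ᶠ x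
above⇒Above (z ∷ zs) x y eq | yes refl with anyᴸ? (y ≟ᶠ_) zs
... | yes y∈zs = top y∈zs
above⇒Above (z ∷ zs) x y () | yes refl | no _
above⇒Above (z ∷ zs) x y eq | no z≢x with z ≟ᶠ y
above⇒Above (z ∷ zs) x y () | no z≢x | yes _
... | no z≢y = pass z≢x z≢y (above⇒Above zs x y eq)

Above-members : Above r x y → x ∈ r × y ∈ r
Above-members (top y∈) = here refl , there y∈
Above-members (pass _ _ a) with Above-members a
... | x∈ , y∈ = there x∈ , there y∈

Above-trans : Above r x y → Above r y z → Above r x z
Above-trans (top _) (top z∈) = top z∈
Above-trans (top _) (pass _ _ a) = top (proj₂ (Above-members a))
Above-trans (pass _ y≢y _) (top _) = ⊥-elim (y≢y refl)
Above-trans (pass w≢x _ a) (pass _ w≢z b) = pass w≢x w≢z (Above-trans a b)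

Above-irrefl : Unique r → ¬ Above r x x
Above-irrefl (fresh ∷ _) (top x∈) = All¬⇒¬Any fresh x∈
Above-irrefl (_ ∷ u) (pass _ _ a) = Above-irrefl u a

Above-asym : Unique r → Above r x y → ¬ Above r y x
Above-asym u a b = Above-irrefl u (Above-trans a b)

Above-≢ : Unique r → Above r x y → x ≢ y
Above-≢ u a refl = Above-irrefl u a

Above-total : x ∈ r → y ∈ r → x ≢ y → Above r x y ⊎ Above r y x
Above-total (here refl) (here refl) x≢y = ⊥-elim (x≢y refl)
Above-total (here refl) (there y∈) _ = inj₁ (top y∈)
Above-total (there x∈) (here refl) _ = inj₂ (top x∈)
Above-total {x = x} {r = z ∷ _} {y = y} (there x∈) (there y∈) x≢y with z ≟ᶠ x | z ≟ᶠ y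
... | yes refl | _ = inj₁ (top y∈)
... | no _ | yes refl = inj₂ (top x∈)
... | no z≢x | no z≢y with Above-total x∈ y∈ x≢y
...   | inj₁ a = inj₁ (pass z≢x z≢y a)
...   | inj₂ a = inj₂ (pass z≢y z≢x a)

true≢false : true ≢ false
true≢false ()

Above? : ∀ (r : Order n) x y → Dec (Above r x y)
Above? r x y with above r x y in eq
... | true = yes (above⇒Above r x y eq)
... | false = no λ a → true≢false (trans (sym (Above⇒above a)) eq)

Above-flip : IsLinOrd r → x ≢ y → ¬ Above r x y → Above r y x
Above-flip {x = x} {y} (_ , complete) x≢y ¬xy with Above-total (complete x) (complete y) x≢y
... | inj₁ xy = ⊥-elim (¬xy xy)
... | inj₂ yx = yx

ranking-ext : ∀ (r s : Order n) → Unique r → Unique s →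
  (∀ x → x ∈ r → x ∈ s) → (∀ x → x ∈ s → x ∈ r) →
  (∀ x y → Above s x y → Above r x y) → (∀ x y → Above r x y → Above s x y) → r ≡ s
ranking-ext [] [] _ _ _ _ _ _ = refl
ranking-ext [] (w ∷ _) _ _ _ s⊆r _ _ with s⊆r w (here refl)
... | ()
ranking-ext (z ∷ _) [] _ _ r⊆s _ _ _ with r⊆s z (here refl)
... | ()
ranking-ext (z ∷ zs) (w ∷ ws) (zfresh ∷ ur) (wfresh ∷ us) r⊆s s⊆r s⇒r r⇒s with z ≟ᶠ w
... | no z≢w = ⊥-elim (Above-asym (wfresh ∷ us) (r⇒s z w (top w∈zs)) (top z∈ws))
  where
  w∈zs : w ∈ zs
  w∈zs with s⊆r w (here refl)
  ... | here w≡z = ⊥-elim (z≢w (sym w≡z))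
  ... | there w∈ = w∈
  z∈ws : z ∈ ws
  z∈ws with r⊆s z (here refl)
  ... | here z≡w = ⊥-elim (z≢w z≡w)
  ... | there z∈ = z∈
... | yes refl = cong (z ∷_) (ranking-ext zs ws ur us (tail-⊆ zfresh r⊆s) (tail-⊆ wfresh s⊆r)
                                 (tail-Above wfresh s⇒r) (tail-Above zfresh r⇒s))
  where
  tail-⊆ : ∀ {as bs} → All (z ≢_) as → (∀ x → x ∈ z ∷ as → x ∈ z ∷ bs) → ∀ x → x ∈ as → x ∈ bs
  tail-⊆ fresh ⊆ x x∈ with ⊆ x (there x∈)
  ... | here refl = ⊥-elim (All-lookup fresh x∈ refl)
  ... | there x∈' = x∈'
  tail-Above : ∀ {as bs} → All (z ≢_) as →
    (∀ x y → Above (z ∷ as) x y → Above (z ∷ bs) x y) → ∀ x y → Above as x y → Above bs x y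
  tail-Above fa h x y a with Above-members a
  ... | x∈ , y∈ with h x y (pass (All-lookup fa x∈) (All-lookup fa y∈) a)
  ...   | top _ = ⊥-elim (All-lookup fa x∈ refl)
  ...   | pass _ _ b = b

linear-ext : IsLinOrd r → ∀ {s} → IsLinOrd s → (∀ x y → Above s x y → Above r x y) → r ≡ s
linear-ext {r = r} (ur , cr) {s} (us , cs) s⇒r =
  ranking-ext r s ur us (λ x _ → cs x) (λ x _ → cr x) s⇒r r⇒s
  where
  r⇒s : ∀ x y → Above r x y → Above s x y
  r⇒s x y a with Above? s x y
  ... | yes b = b
  ... | no ¬b = ⊥-elim (Above-asym ur a (s⇒r y x (Above-flip (us , cs) (Above-≢ ur a) ¬b)))

distinct-orders-disagree : ∀ {r s : Order n} → IsLinOrd r → IsLinOrd s → r ≢ s →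
  ∃ λ x → ∃ λ y → Above r x y × Above s y x
distinct-orders-disagree {r = r} {s} r-lin s-lin r≢s
  with any? (λ x → any? (λ y → Above? r x y ×-dec Above? s y x))
... | yes (x , y , disagree) = x , y , disagree
... | no agree = ⊥-elim (r≢s (linear-ext r-lin s-lin s⇒r))
  where
  s⇒r : ∀ x y → Above s x y → Above r x y
  s⇒r x y xy with Above? r x y
  ... | yes xyʳ = xyʳ
  ... | no ¬xyʳ = ⊥-elim (agree (y , x , Above-flip r-lin (Above-≢ (proj₁ s-lin) xy) ¬xyʳ , xy))

data Consec {n} : Order n → Fin n → Fin n → Set where
  now   : ∀ {x y zs} → Consec (x ∷ y ∷ zs) x y
  later : ∀ {z x y r} → Consec r x y → Consec (z ∷ r) x y

Between : Order n → Fin n → Fin n → Fin n → Set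
Between r x z y = Above r x z × Above r z y

Consec⇒Above : Unique r → Consec r x y → Above r x y
Consec⇒Above _ now = top (here refl)
Consec⇒Above (fresh ∷ u) (later c) with Above-members (Consec⇒Above u c)
... | x∈ , y∈ = pass (All-lookup fresh x∈) (All-lookup fresh y∈) (Consec⇒Above u c)

Consec⇒nothing-between : Unique r → Consec r x y → ∀ z → ¬ Between r x z y
Consec⇒nothing-between u now z (xz , top _) = Above-irrefl u xz
Consec⇒nothing-between (_ ∷ yfresh ∷ _) now z (_ , pass _ _ (top y∈)) = All¬⇒¬Any yfresh y∈
Consec⇒nothing-between u now z (_ , pass _ _ (pass _ y≢y _)) = y≢y refl
Consec⇒nothing-between (fresh ∷ u) (later c) z (top _ , _) =
  All-lookup fresh (proj₁ (Above-members (Consec⇒Above u c))) refl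
Consec⇒nothing-between (fresh ∷ u) (later c) z (pass _ _ xz , top _) =
  All-lookup fresh (proj₂ (Above-members xz)) refl
Consec⇒nothing-between (_ ∷ u) (later c) z (pass _ _ xz , pass _ _ zy) =
  Consec⇒nothing-between u c z (xz , zy)

nothing-between⇒Consec : Unique r → Above r x y → (∀ z → ¬ Between r x z y) → Consec r x y
nothing-between⇒Consec _ (top (here refl)) _ = now
nothing-between⇒Consec ((x≢w ∷ xfresh) ∷ wfresh ∷ _) (top {r = w ∷ _} (there y∈)) empty =
  ⊥-elim (empty w (top (here refl) , pass x≢w (All-lookup xfresh y∈) (top y∈)))
nothing-between⇒Consec (zfresh ∷ u) (pass z≢x z≢y a) empty =
  later (nothing-between⇒Consec u a λ w (xw , wy) →
    let z≢w = All-lookup zfresh (proj₂ (Above-members xw))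
    in empty w (pass z≢x z≢w xw , pass z≢w z≢y wy))

Consec-members : Consec r x y → x ∈ r × y ∈ r
Consec-members now = here refl , there (here refl)
Consec-members (later c) with Consec-members c
... | x∈ , y∈ = there x∈ , there y∈

lower-in-tail : ∀ {w zs} → Consec (w ∷ zs) x y → y ∈ zs
lower-in-tail now = here refl
lower-in-tail (later c) = proj₂ (Consec-members c)

Consec-successor-unique : Unique r → Consec r x y → Consec r x z → y ≡ z
Consec-successor-unique _ now now = refl
Consec-successor-unique (xfresh ∷ _) now (later c) = ⊥-elim (All-lookup xfresh (proj₁ (Consec-members c)) refl)
Consec-successor-unique (xfresh ∷ _) (later c) now = ⊥-elim (All-lookup xfresh (proj₁ (Consec-members c)) refl)
Consec-successor-unique (_ ∷ u) (later c) (later c′) = Consec-successor-unique u c c′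

Consec-predecessor-unique : Unique r → Consec r x z → Consec r y z → x ≡ y
Consec-predecessor-unique _ now now = refl
Consec-predecessor-unique (_ ∷ zfresh ∷ _) now (later c) = ⊥-elim (All-lookup zfresh (lower-in-tail c) refl)
Consec-predecessor-unique (_ ∷ zfresh ∷ _) (later c) now = ⊥-elim (All-lookup zfresh (lower-in-tail c) refl)
Consec-predecessor-unique (_ ∷ u) (later c) (later c′) = Consec-predecessor-unique u c c′

SamePair : Fin n → Fin n → Fin n → Fin n → Set
SamePair x y p q = (p ≡ x × q ≡ y) ⊎ (p ≡ y × q ≡ x)

samePair? : ∀ (x y p q : Fin n) → Dec (SamePair x y p q)
samePair? x y p q = ((p ≟ᶠ x) ×-dec (q ≟ᶠ y)) ⊎-dec ((p ≟ᶠ y) ×-dec (q ≟ᶠ x))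

SamePair-flip : SamePair x y p q → SamePair x y q p
SamePair-flip (inj₁ (p≡x , q≡y)) = inj₂ (q≡y , p≡x)
SamePair-flip (inj₂ (p≡y , q≡x)) = inj₁ (q≡x , p≡y)

transpose : ∀ {n} {r : Order n} {x y} → Consec r x y → Order n
transpose (now {x = x} {y} {zs}) = y ∷ x ∷ zs
transpose (later {z = z} c) = z ∷ transpose c

transpose-consec : (c : Consec r x y) → Consec (transpose c) y x
transpose-consec now = now
transpose-consec (later c) = later (transpose-consec c)

transpose-↭ : (c : Consec r x y) → r ↭ transpose c
transpose-↭ now = swap _ _ ↭-refl
transpose-↭ (later c) = prep _ (transpose-↭ c)

transpose-unique : Unique r → (c : Consec r x y) → Unique (transpose c)
transpose-unique ((x≢y ∷ xfresh) ∷ yfresh ∷ u) now = ((λ y≡x → x≢y (sym y≡x)) ∷ yfresh) ∷ xfresh ∷ u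
transpose-unique (zfresh ∷ u) (later c) = All-resp-↭ (transpose-↭ c) zfresh ∷ transpose-unique u c

transpose-linear : IsLinOrd r → (c : Consec r x y) → IsLinOrd (transpose c)
transpose-linear (u , complete) c = transpose-unique u c , λ w → ∈-resp-↭ (transpose-↭ c) (complete w)

transpose-flips : Unique r → (c : Consec r x y) → Above (transpose c) y x
transpose-flips _ now = top (here refl)
transpose-flips (zfresh ∷ u) (later c) with Above-members (Consec⇒Above u c)
... | x∈ , y∈ = pass (All-lookup zfresh y∈) (All-lookup zfresh x∈) (transpose-flips u c)

transpose-keeps : Unique r → (c : Consec r x y) → ¬ SamePair x y p q → Above r p q → Above (transpose c) p q
transpose-keeps _ now other (top (here refl)) = ⊥-elim (other (inj₁ (refl , refl)))
transpose-keeps ((x≢y ∷ _) ∷ yfresh ∷ _) now _ (top (there q∈)) =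
  pass (λ y≡x → x≢y (sym y≡x)) (All-lookup yfresh q∈) (top q∈)
transpose-keeps _ now _ (pass _ _ (top q∈)) = top (there q∈)
transpose-keeps _ now _ (pass x≢p x≢q (pass y≢p y≢q a)) = pass y≢p y≢q (pass x≢p x≢q a)
transpose-keeps _ (later c) _ (top q∈) = top (∈-resp-↭ (transpose-↭ c) q∈)
transpose-keeps (_ ∷ u) (later c) other (pass z≢p z≢q a) = pass z≢p z≢q (transpose-keeps u c other a)

transpose-reflects : IsLinOrd r → (c : Consec r x y) → ¬ SamePair x y p q → Above (transpose c) p q → Above r p q
transpose-reflects {r = r} {p = p} {q} lin c other a with Above? r p q
... | yes b = b
... | no ¬b = ⊥-elim (Above-asym u′ a (transpose-keeps (proj₁ lin) c (λ s → other (SamePair-flip s)) qp))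
  where
  u′ = transpose-unique (proj₁ lin) c
  qp = Above-flip lin (Above-≢ u′ a) ¬b

module _ (T : Fin n → Fin n → Set) (T? : ∀ x y → Dec (T x y)) (T-trans : ∀ {x y z} → T x y → T y z → T x z) where

  refines-or-violation : ∀ r → (∀ x y → Above r x y → T x y) ⊎ (∃ λ x → ∃ λ y → Consec r x y × ¬ T x y)
  refines-or-violation [] = inj₁ λ _ _ ()
  refines-or-violation (_ ∷ []) = inj₁ λ { _ _ (top ()) ; _ _ (pass _ _ ()) }
  refines-or-violation (z ∷ w ∷ ws) with T? z w | refines-or-violation (w ∷ ws)
  ... | no ¬Tzw | _ = inj₂ (z , w , now , ¬Tzw)
  ... | yes _ | inj₂ (x , y , c , ¬Txy) = inj₂ (x , y , later c , ¬Txy)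
  ... | yes Tzw | inj₁ refines = inj₁ λ where
    _ _ (top (here refl)) → Tzw
    _ y (top (there y∈)) → T-trans Tzw (refines w y (top y∈))
    x y (pass _ _ a) → refines x y a

IntervalBelow : ℕ → (ℕ → Set) → Set
IntervalBelow m Q = ∀ i j k → i ≤ j → j ≤ k → k < m → Q i → Q k → Q j

InjectiveBelow : ∀ {A : Set} → ℕ → (ℕ → A) → Set
InjectiveBelow m F = ∀ i j → i < m → j < m → F i ≡ F j → i ≡ j

pred< : ∀ {p j m} → p < j → j ≤ m → pred j < m
pred< {j = suc _} _ j≤m = j≤m

-- How the truth value W of a property at a new element inserted at position p
-- relates to its values Q along a sequence of length m: W copies the value at
-- the left or right neighbour, or the element is appended and W excludes Q.
data Fits (m p : ℕ) (Q : ℕ → Set) (W : Set) : Set where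
  like-left  : 0 < p → W ⇔ Q (pred p) → Fits m p Q W
  like-right : p < m → W ⇔ Q p → Fits m p Q W
  fresh-last : p ≡ m → (W → ∀ j → j < m → ¬ Q j) → Fits m p Q W

module _ {m p : ℕ} {Q : ℕ → Set} {W : Set} (p≤m : p ≤ m) (interval : IntervalBelow m Q) where

  fits-join : Fits m p Q W → ∀ {i k} → i < p → p ≤ k → k < m → Q i → Q k → W
  fits-join (like-left 0<p W⇔Q) {i} {k} i<p p≤k k<m qi qk =
    Equivalence.from W⇔Q (interval i (pred p) k (<⇒≤pred i<p) (≤⇒pred≤ p≤k) k<m qi qk)
  fits-join (like-right _ W⇔Q) {i} {k} i<p p≤k k<m qi qk =
    Equivalence.from W⇔Q (interval i p k (<⇒≤ i<p) p≤k k<m qi qk)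
  fits-join (fresh-last refl _) _ p≤k k<m _ _ = ⊥-elim (<⇒≱ k<m p≤k)

  fits-upward : Fits m p Q W → W → ∀ {j k} → p ≤ j → j ≤ k → k < m → Q k → Q j
  fits-upward (like-left _ W⇔Q) w {j} {k} p≤j j≤k k<m qk =
    interval (pred p) j k (≤⇒pred≤ p≤j) j≤k k<m (Equivalence.to W⇔Q w) qk
  fits-upward (like-right _ W⇔Q) w {j} {k} p≤j j≤k k<m qk =
    interval p j k p≤j j≤k k<m (Equivalence.to W⇔Q w) qk
  fits-upward (fresh-last refl _) _ p≤j j≤k k<m _ = ⊥-elim (<⇒≱ k<m (≤-trans p≤j j≤k))

  fits-downward : Fits m p Q W → W → ∀ {i j} → i ≤ j → j < p → Q i → Q j
  fits-downward (like-left 0<p W⇔Q) w {i} {j} i≤j j<p qi =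
    interval i j (pred p) i≤j (<⇒≤pred j<p) (pred< 0<p p≤m) qi (Equivalence.to W⇔Q w)
  fits-downward (like-right p<m W⇔Q) w {i} {j} i≤j j<p qi =
    interval i j p i≤j (<⇒≤ j<p) p<m qi (Equivalence.to W⇔Q w)
  fits-downward (fresh-last refl excl) w {i} i≤j j<p qi = ⊥-elim (excl w i (<-≤-trans (≤-<-trans i≤j j<p) p≤m) qi)

module _ {A : Set} where

  insertAt : ℕ → A → (ℕ → A) → ℕ → A
  insertAt p w F j with <-cmp j p
  ... | tri< _ _ _ = F j
  ... | tri≈ _ _ _ = w
  ... | tri> _ _ _ = F (pred j)

  module _ {p : ℕ} {w : A} {F : ℕ → A} where

    insertAt-below : ∀ {j} → j < p → insertAt p w F j ≡ F j
    insertAt-below {j} j<p with <-cmp j p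
    ... | tri< _ _ _ = refl
    ... | tri≈ ¬j<p _ _ = ⊥-elim (¬j<p j<p)
    ... | tri> ¬j<p _ _ = ⊥-elim (¬j<p j<p)

    insertAt-at : insertAt p w F p ≡ w
    insertAt-at with <-cmp p p
    ... | tri< _ p≢p _ = ⊥-elim (p≢p refl)
    ... | tri≈ _ _ _ = refl
    ... | tri> _ p≢p _ = ⊥-elim (p≢p refl)

    insertAt-above : ∀ {j} → p < j → insertAt p w F j ≡ F (pred j)
    insertAt-above {j} p<j with <-cmp j p
    ... | tri< _ _ ¬p<j = ⊥-elim (¬p<j p<j)
    ... | tri≈ _ _ ¬p<j = ⊥-elim (¬p<j p<j)
    ... | tri> _ _ _ = refl

    module _ {m} (p≤m : p ≤ m) (inj : InjectiveBelow m F) (new : ∀ j → j < m → F j ≢ w) where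

      private
        pred-strict : ∀ {i j} → p < i → i < j → pred i < pred j
        pred-strict {suc _} {suc _} _ (s≤s i<j) = i<j

      insertAt-distinct : ∀ {i j} → i < j → j ≤ m → insertAt p w F i ≢ insertAt p w F j
      insertAt-distinct {i} {j} i<j j≤m eq with <-cmp i p | <-cmp j p
      ... | tri< i<p _ _ | tri< j<p _ _ =
        <⇒≢ i<j (inj i j (<-≤-trans i<p p≤m) (<-≤-trans j<p p≤m) eq)
      ... | tri< i<p _ _ | tri≈ _ refl _ =
        new i (<-≤-trans i<p p≤m) eq
      ... | tri< i<p _ _ | tri> _ _ p<j =
        <⇒≢ (<-≤-trans i<p (<⇒≤pred p<j)) (inj i (pred j) (<-≤-trans i<p p≤m) (pred< p<j j≤m) eq)
      ... | tri≈ _ refl _ | tri> _ _ p<j =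
        new (pred j) (pred< p<j j≤m) (sym eq)
      ... | tri> _ _ p<i | tri> _ _ p<j =
        <⇒≢ (pred-strict p<i i<j) (inj (pred i) (pred j) (pred< p<i (<⇒≤ (<-≤-trans i<j j≤m))) (pred< p<j j≤m) eq)
      ... | tri≈ _ refl _ | tri< j<p _ _ = <-asym i<j j<p
      ... | tri≈ _ refl _ | tri≈ _ refl _ = <-irrefl refl i<j
      ... | tri> _ _ p<i | tri< j<p _ _ = <-asym (<-trans p<i i<j) j<p
      ... | tri> _ _ p<i | tri≈ _ refl _ = <-asym p<i i<j

      insertAt-injective : InjectiveBelow (suc m) (insertAt p w F)
      insertAt-injective i j (s≤s i≤m) (s≤s j≤m) eq with <-cmp i j
      ... | tri≈ _ i≡j _ = i≡j
      ... | tri< i<j _ _ = ⊥-elim (insertAt-distinct i<j j≤m eq)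
      ... | tri> _ _ j<i = ⊥-elim (insertAt-distinct j<i i≤m (sym eq))

    insertAt-interval : ∀ {m} (P : A → Set) → p ≤ m → IntervalBelow m (λ j → P (F j)) →
      Fits m p (λ j → P (F j)) (P w) → IntervalBelow (suc m) (λ j → P (insertAt p w F j))
    insertAt-interval {m} P p≤m interval fits i j k i≤j j≤k (s≤s k≤m) Pi Pk with <-cmp j p
    ... | tri< j<p _ _ with <-cmp i p | <-cmp k p
    ...   | tri< _ _ _ | tri< k<p _ _ = interval i j k i≤j j≤k (<-≤-trans k<p p≤m) Pi Pk
    ...   | tri< _ _ _ | tri≈ _ refl _ = fits-downward p≤m interval fits Pk i≤j j<p Pi
    ...   | tri< _ _ _ | tri> _ _ p<k = interval i j (pred k) i≤j (<⇒≤pred (<-trans j<p p<k)) (pred< p<k k≤m) Pi Pk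
    ...   | tri≈ _ refl _ | _ = ⊥-elim (<⇒≱ j<p i≤j)
    ...   | tri> _ _ p<i | _ = ⊥-elim (<⇒≱ (<-trans j<p p<i) i≤j)
    insertAt-interval {m} P p≤m interval fits i j k i≤j j≤k (s≤s k≤m) Pi Pk
        | tri≈ _ refl _ with <-cmp i p | <-cmp k p
    ...   | tri≈ _ refl _ | _ = Pi
    ...   | _ | tri≈ _ refl _ = Pk
    ...   | tri< i<p _ _ | tri> _ _ p<k = fits-join p≤m interval fits i<p (<⇒≤pred p<k) (pred< p<k k≤m) Pi Pk
    ...   | tri> _ _ p<i | _ = ⊥-elim (<⇒≱ p<i i≤j)
    ...   | _ | tri< k<p _ _ = ⊥-elim (<⇒≱ k<p j≤k)
    insertAt-interval {m} P p≤m interval fits i j k i≤j j≤k (s≤s k≤m) Pi Pk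
        | tri> _ _ p<j with <-cmp i p | <-cmp k p
    ...   | tri< i<p _ _ | tri> _ _ p<k =
      interval i (pred j) (pred k) (<⇒≤pred (<-trans i<p p<j)) (pred-mono-≤ j≤k) (pred< p<k k≤m) Pi Pk
    ...   | tri≈ _ refl _ | tri> _ _ p<k =
      fits-upward p≤m interval fits Pi (<⇒≤pred p<j) (pred-mono-≤ j≤k) (pred< p<k k≤m) Pk
    ...   | tri> _ _ p<i | tri> _ _ p<k =
      interval (pred i) (pred j) (pred k) (pred-mono-≤ i≤j) (pred-mono-≤ j≤k) (pred< p<k k≤m) Pi Pk
    ...   | _ | tri< k<p _ _ = ⊥-elim (<⇒≱ (<-trans p<j (≤-<-trans j≤k k<p)) ≤-refl)
    ...   | _ | tri≈ _ refl _ = ⊥-elim (<⇒≱ p<j j≤k)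

agrees-with-one : ∀ {W Qa Qb : Set} → Dec W → Dec Qa → Dec Qb →
  (Qa → Qb → W) → (W → Qa ⊎ Qb) → (W ⇔ Qa) ⊎ (W ⇔ Qb)
agrees-with-one (yes w) (yes qa) _ _ _ = inj₁ (mk⇔ (λ _ → qa) (λ _ → w))
agrees-with-one (yes w) (no ¬qa) _ _ one with one w
... | inj₁ qa = ⊥-elim (¬qa qa)
... | inj₂ qb = inj₂ (mk⇔ (λ _ → qb) (λ _ → w))
agrees-with-one (no ¬w) (no ¬qa) _ _ _ = inj₁ (mk⇔ (λ w → ⊥-elim (¬w w)) (λ qa → ⊥-elim (¬qa qa)))
agrees-with-one (no ¬w) (yes qa) (yes qb) both _ = ⊥-elim (¬w (both qa qb))
agrees-with-one (no ¬w) (yes _) (no ¬qb) _ _ = inj₂ (mk⇔ (λ w → ⊥-elim (¬w w)) (λ qb → ⊥-elim (¬qb qb)))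

crossing : (Q : ℕ → Set) → (∀ j → Dec (Q j)) → ∀ k → Q 0 → ¬ Q k → ∃ λ τ → suc τ ≤ k × Q τ × ¬ Q (suc τ)
crossing Q Q? zero q₀ ¬q₀ = ⊥-elim (¬q₀ q₀)
crossing Q Q? (suc k) q₀ ¬qₖ₊₁ with Q? k
... | yes qₖ = k , ≤-refl , qₖ , ¬qₖ₊₁
... | no ¬qₖ with crossing Q Q? k q₀ ¬qₖ
...   | τ , τ<k , qτ , ¬qτ₊₁ = τ , m≤n⇒m≤1+n τ<k , qτ , ¬qτ₊₁

does⇒ : ∀ {A : Set} (a? : Dec A) → does a? ≡ true → A
does⇒ (yes a) _ = a

count-mono : ∀ k (f g : Fin k → Bool) → (∀ v → f v ≡ true → g v ≡ true) → count k f ≤ count k g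
count-mono zero f g f⊆g = z≤n
count-mono (suc k) f g f⊆g with f Fin.zero in f₀ | g Fin.zero in g₀
... | true | true = s≤s (count-mono k _ _ (λ v → f⊆g (Fin.suc v)))
... | true | false = ⊥-elim (true≢false (trans (sym (f⊆g Fin.zero f₀)) g₀))
... | false | true = m≤n⇒m≤1+n (count-mono k _ _ (λ v → f⊆g (Fin.suc v)))
... | false | false = count-mono k _ _ (λ v → f⊆g (Fin.suc v))

count-complement : ∀ k (f : Fin k → Bool) → count k f + count k (λ v → not (f v)) ≡ k
count-complement zero f = refl
count-complement (suc k) f with f Fin.zero
... | true = cong suc (count-complement k _)
... | false = trans (+-suc _ _) (cong suc (count-complement k _))

count-all : ∀ k (f : Fin k → Bool) → (∀ v → f v ≡ true) → count k f ≡ k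
count-all zero f all = refl
count-all (suc k) f all rewrite all Fin.zero = cong suc (count-all k _ (λ v → all (Fin.suc v)))

count-one : ∀ k (f : Fin k → Bool) {i} → f i ≡ true → 1 ≤ count k f
count-one (suc k) f {Fin.zero} fᵢ rewrite fᵢ = s≤s z≤n
count-one (suc k) f {Fin.suc i} fᵢ = ≤-trans (count-one k _ fᵢ) (m≤n+m _ _)

count-two : ∀ k (f : Fin k → Bool) {i j} → i ≢ j → f i ≡ true → f j ≡ true → 2 ≤ count k f
count-two (suc k) f {Fin.zero} {Fin.zero} i≢j _ _ = ⊥-elim (i≢j refl)
count-two (suc k) f {Fin.zero} {Fin.suc _} _ fᵢ fⱼ rewrite fᵢ = s≤s (count-one k _ fⱼ)
count-two (suc k) f {Fin.suc _} {Fin.zero} _ fᵢ fⱼ rewrite fⱼ = s≤s (count-one k _ fᵢ)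
count-two (suc k) f {Fin.suc _} {Fin.suc _} i≢j fᵢ fⱼ =
  ≤-trans (count-two k _ (λ i≡j → i≢j (cong Fin.suc i≡j)) fᵢ fⱼ) (m≤n+m _ _)

majorities-intersect : ∀ k (f g : Fin k → Bool) → k < 2 * count k f → k < 2 * count k g →
  ∃ λ v → f v ≡ true × g v ≡ true
majorities-intersect k f g maj-f maj-g with any? (λ v → (f v ≟ᵇ true) ×-dec (g v ≟ᵇ true))
... | yes shared = shared
... | no disjoint = ⊥-elim (<-irrefl refl (<-≤-trans (+-mono-< maj-f maj-g) too-few))
  where
  a = count k f
  b = count k g
  c = count k (λ v → not (f v))
  g⊆¬f : ∀ v → g v ≡ true → not (f v) ≡ true
  g⊆¬f v gᵥ with f v in fᵥ
  ... | true = ⊥-elim (disjoint (v , fᵥ , gᵥ))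
  ... | false = refl
  too-few : 2 * a + 2 * b ≤ k + k
  too-few = begin
    2 * a + 2 * b   ≤⟨ +-monoʳ-≤ (2 * a) (*-monoʳ-≤ 2 (count-mono k g _ g⊆¬f)) ⟩
    2 * a + 2 * c   ≡⟨ *-distribˡ-+ 2 a c ⟨
    2 * (a + c)     ≡⟨ cong (2 *_) (count-complement k f) ⟩
    2 * k           ≡⟨ cong (k +_) (+-identityʳ k) ⟩
    k + k           ∎
    where open ≤-Reasoning

module _ (k : ℕ) (pos : Fin k → ℕ) where

  private
    atOrBefore : ℕ → Fin k → Bool
    atOrBefore t v = does (pos v ≤? t)

    Early : ℕ → Set
    Early t = k < 2 * count k (atOrBefore t)

    Early? : ∀ t → Dec (Early t)
    Early? t = k <? 2 * count k (atOrBefore t)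

    early-last : ∀ {m} → 0 < k → (∀ v → pos v < m) → Early (pred m)
    early-last {m} 0<k pos<m =
      subst (λ c → k < 2 * c) (sym (count-all k _ (λ v → dec-true (pos v ≤? pred m) (<⇒≤pred (pos<m v)))))
        (m<m+n k (≤-trans 0<k (m≤m+n k 0)))

    some-position : ∀ {m} → 0 < k → (∀ v → pos v < m) → 0 < m
    some-position 0<k pos<m = ≤-<-trans z≤n (pos<m (fromℕ< 0<k))

    reaches-early : ∀ {τ} (f : Fin k → Bool) → Early τ → k < 2 * count k f → ∃ λ v → f v ≡ true × pos v ≤ τ
    reaches-early {τ} f early maj with majorities-intersect k f (atOrBefore τ) maj early
    ... | v , fᵥ , v-early = v , fᵥ , does⇒ (pos v ≤? τ) v-early

    reaches-late : ∀ {s} (f : Fin k → Bool) → ¬ Early s → k < 2 * count k f → ∃ λ v → f v ≡ true × suc s ≤ pos v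
    reaches-late {s} f ¬early maj with any? (λ v → (f v ≟ᵇ true) ×-dec (suc s ≤? pos v))
    ... | yes late = late
    ... | no none = ⊥-elim (¬early (<-≤-trans maj (*-monoʳ-≤ 2 (count-mono k f (atOrBefore s) f-early))))
      where
      f-early : ∀ v → f v ≡ true → atOrBefore s v ≡ true
      f-early v fᵥ = dec-true (pos v ≤? s) (≮⇒≥ λ s<pos → none (v , fᵥ , s<pos))

  median-voter : ∀ {m} → 0 < k → (∀ v → pos v < m) →
    ∃ λ τ → τ < m × (∀ (f : Fin k → Bool) → k < 2 * count k f →
      (∃ λ v → f v ≡ true × pos v ≤ τ) × (∃ λ v → f v ≡ true × τ ≤ pos v))
  median-voter {m} 0<k pos<m with Early? 0
  ... | yes early₀ = 0 , some-position 0<k pos<m , λ f maj → reaches-early f early₀ maj , some-member f maj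
    where
    some-member : ∀ f → k < 2 * count k f → ∃ λ v → f v ≡ true × 0 ≤ pos v
    some-member f maj = let (v , fᵥ , _) = majorities-intersect k f f maj maj in v , fᵥ , z≤n
  ... | no ¬early₀
    with crossing (λ t → ¬ Early t) (λ t → ¬? (Early? t)) (pred m) ¬early₀ (λ ¬e → ¬e (early-last 0<k pos<m))
  ...   | s , s+1≤last , ¬earlyₛ , ¬¬earlyₛ₊₁ =
    suc s , ≤-<-trans s+1≤last (pred< (some-position 0<k pos<m) ≤-refl) ,
    λ f maj → reaches-early f (decidable-stable (Early? (suc s)) ¬¬earlyₛ₊₁) maj , reaches-late f ¬earlyₛ maj

Acyclic-within : ∀ {M : Fin n → Fin n → Set} (L : Order n) → Unique L → (∀ x y → M x y → Above L x y) → Acyclic M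
Acyclic-within {M = M} L u M⊆L x cycle = Above-irrefl u (path cycle)
  where
  path : ∀ {x y} → TransClosure M x y → Above L x y
  path [ xy ] = M⊆L _ _ xy
  path (xy ∷ rest) = Above-trans (M⊆L _ _ xy) (path rest)

two-of-three : ∀ (f : Fin 3 → Bool) {i j} → i ≢ j → f i ≡ true → f j ≡ true → 3 < 2 * count 3 f
two-of-three f i≢j fᵢ fⱼ = *-monoʳ-≤ 2 (count-two 3 f i≢j fᵢ fⱼ)

-- Three orders such that each of x>y, y>z, z>x holds in two of them give a
-- profile with a cyclic majority, so they never lie in a common Condorcet domain.
condorcet-cycle : ∀ {D' : Domain n} → IsCondorcet D' → ∀ {P₀ P₁ P₂ x y z} → D' P₀ → D' P₁ → D' P₂ →
  Above P₀ x y → Above P₁ x y → Above P₀ y z → Above P₂ y z → Above P₁ z x → Above P₂ z x → ⊥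
condorcet-cycle {n} {D'} (_ , acyclic) {P₀} {P₁} {P₂} {x} {y} {z} d₀ d₁ d₂ xy⁰ xy¹ yz⁰ yz² zx¹ zx² =
  acyclic 3 P P-in-D' x (majority (λ ()) xy⁰ xy¹ ∷ majority (λ ()) yz⁰ yz² ∷ [ majority (λ ()) zx¹ zx² ])
  where
  P : Fin 3 → Order n
  P Fin.zero = P₀
  P (Fin.suc Fin.zero) = P₁
  P (Fin.suc (Fin.suc Fin.zero)) = P₂
  P-in-D' : ∀ i → D' (P i)
  P-in-D' Fin.zero = d₀
  P-in-D' (Fin.suc Fin.zero) = d₁
  P-in-D' (Fin.suc (Fin.suc Fin.zero)) = d₂
  majority : ∀ {i j p q} → i ≢ j → Above (P i) p q → Above (P j) p q → Majority 3 P p q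
  majority i≢j pqⁱ pqʲ = two-of-three _ i≢j (Above⇒above pqⁱ) (Above⇒above pqʲ)

sequence-enumeration : ∀ (D' : Domain n) m (F : ℕ → Order n) → InjectiveBelow m F →
  (∀ j → j < m → D' (F j)) → (∀ r → D' r → ∃ λ j → j < m × F j ≡ r) →
  (∀ x y → x ≢ y → IntervalBelow m (λ j → Above (F j) x y)) →
  IsSCEnumeration D' m (λ i → F (toℕ i))
sequence-enumeration D' m F inj inD onto interval =
  (λ {i} {j} eq → toℕ-injective (inj (toℕ i) (toℕ j) (toℕ<n i) (toℕ<n j) eq)) ,
  (λ i → inD (toℕ i) (toℕ<n i)) ,
  (λ r d → let (j , j<m , Fj≡r) = onto r d
           in fromℕ< j<m , subst (λ q → F q ≡ r) (sym (toℕ-fromℕ< j<m)) Fj≡r) ,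
  (λ x y x≢y → fin-interval x y x≢y , fin-interval y x (λ y≡x → x≢y (sym y≡x)))
  where
  fin-interval : ∀ x y → x ≢ y → Interval (λ j → above (F (toℕ j)) x y ≡ true)
  fin-interval x y x≢y i j k i≤j j≤k xyi xyk = Above⇒above (interval x y x≢y (toℕ i) (toℕ j) (toℕ k)
    i≤j j≤k (toℕ<n k) (above⇒Above _ x y xyi) (above⇒Above _ x y xyk))

module Chain (D : Domain n) (isD : IsDomain D) (m : ℕ) (e : Fin m → Order n) (sc : IsSCEnumeration D m e) where

  E : ℕ → Order n
  E j with j <? m
  ... | yes j<m = e (fromℕ< j<m)
  ... | no _ = []

  E-toℕ : ∀ i → E (toℕ i) ≡ e i
  E-toℕ i with toℕ i <? m
  ... | yes i<m = cong e (fromℕ<-toℕ i i<m)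
  ... | no i≮m = ⊥-elim (i≮m (toℕ<n i))

  E-fromℕ< : ∀ {j} (j<m : j < m) → E j ≡ e (fromℕ< j<m)
  E-fromℕ< j<m = trans (cong E (sym (toℕ-fromℕ< j<m))) (E-toℕ (fromℕ< j<m))

  E-in-D : ∀ {j} → j < m → D (E j)
  E-in-D j<m = subst D (sym (E-fromℕ< j<m)) (proj₁ (proj₂ sc) (fromℕ< j<m))

  E-linear : ∀ {j} → j < m → IsLinOrd (E j)
  E-linear j<m = isD _ (E-in-D j<m)

  E-unique : ∀ {j} → j < m → Unique (E j)
  E-unique j<m = proj₁ (E-linear j<m)

  E-injective : InjectiveBelow m E
  E-injective i j i<m j<m eq = begin
    i                       ≡⟨ toℕ-fromℕ< i<m ⟨
    toℕ (fromℕ< i<m)       ≡⟨ cong toℕ (proj₁ sc (trans (sym (E-fromℕ< i<m)) (trans eq (E-fromℕ< j<m)))) ⟩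
    toℕ (fromℕ< j<m)       ≡⟨ toℕ-fromℕ< j<m ⟩
    j                       ∎
    where open ≡-Reasoning

  E-onto : ∀ r → D r → ∃ λ j → j < m × E j ≡ r
  E-onto r d = let (i , ei≡r) = proj₁ (proj₂ (proj₂ sc)) r d in toℕ i , toℕ<n i , trans (E-toℕ i) ei≡r

  E-interval : ∀ x y → x ≢ y → IntervalBelow m (λ j → Above (E j) x y)
  E-interval x y x≢y i j k i≤j j≤k k<m xyi xyk =
    subst (λ r → Above r x y) (sym (E-fromℕ< j<m))
      (above⇒Above _ x y (proj₁ (proj₂ (proj₂ (proj₂ sc)) x y x≢y) (fromℕ< i<m) (fromℕ< j<m) (fromℕ< k<m)
        (subst₂ _≤_ (sym (toℕ-fromℕ< i<m)) (sym (toℕ-fromℕ< j<m)) i≤j)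
        (subst₂ _≤_ (sym (toℕ-fromℕ< j<m)) (sym (toℕ-fromℕ< k<m)) j≤k)
        (on-fin i<m xyi) (on-fin k<m xyk)))
    where
    j<m = ≤-<-trans j≤k k<m
    i<m = ≤-<-trans i≤j j<m
    on-fin : ∀ {l} (l<m : l < m) → Above (E l) x y → above (e (fromℕ< l<m)) x y ≡ true
    on-fin l<m a = subst (λ r → above r x y ≡ true) (E-fromℕ< l<m) (Above⇒above a)

  E-between : ∀ {x y i j k} → i ≤ j → j ≤ k → k < m → Above (E i) x y → Above (E k) x y → Above (E j) x y
  E-between {x} {y} {i} {j} {k} i≤j j≤k k<m xyi =
    E-interval x y (Above-≢ (E-unique (≤-<-trans (≤-trans i≤j j≤k) k<m)) xyi) i j k i≤j j≤k k<m xyi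

  module _ {k} (P : Fin k → Order n) (inD : ∀ v → D (P v)) where

    private
      pos : Fin k → ℕ
      pos v = proj₁ (E-onto (P v) (inD v))

      pos<m : ∀ v → pos v < m
      pos<m v = proj₁ (proj₂ (E-onto (P v) (inD v)))

      voter-ranks : ∀ {v x y} → above (P v) x y ≡ true → Above (E (pos v)) x y
      voter-ranks {v} {x} {y} xy =
        subst (λ r → Above r x y) (sym (proj₂ (proj₂ (E-onto (P v) (inD v))))) (above⇒Above _ x y xy)

    majority-within-median : 0 < k → ∃ λ τ → τ < m × (∀ x y → Majority k P x y → Above (E τ) x y)
    majority-within-median 0<k with median-voter k pos 0<k pos<m
    ... | τ , τ<m , median = τ , τ<m , within
      where
      within : ∀ x y → Majority k P x y → Above (E τ) x y
      within x y maj with median _ maj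
      ... | (v₁ , xy₁ , v₁≤τ) , (v₂ , xy₂ , τ≤v₂) =
        E-between v₁≤τ τ≤v₂ (pos<m v₂) (voter-ranks xy₁) (voter-ranks xy₂)

  chain-condorcet : IsCondorcet D
  chain-condorcet = isD , acyclic
    where
    acyclic : ∀ k (P : Fin k → Order n) → (∀ v → D (P v)) → Acyclic (Majority k P)
    acyclic zero P _ = Acyclic-within [] [] (λ _ _ ())
    acyclic (suc k) P inD with majority-within-median P inD (s≤s z≤n)
    ... | τ , τ<m , within = Acyclic-within (E τ) (E-unique τ<m) within

  module Maximal (maximal : ∀ (D' : Domain n) → IsSingleCrossing D' → D ⊆D D' → D' ⊆D D) where

    -- (Inserting w at position p gives a single-crossing domain containing D,
    -- so w would already be in D, i.e. in the chain.)
    no-insertion : ∀ {p} (w : Order n) → p ≤ m → IsLinOrd w → (∀ j → j < m → E j ≢ w) →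
      (∀ x y → x ≢ y → Fits m p (λ j → Above (E j) x y) (Above w x y)) → ⊥
    no-insertion {p} w p≤m w-linear new fits with E-onto w (maximal D⁺ D⁺-single-crossing (λ _ → inj₁) w (inj₂ refl))
      where
      D⁺ : Domain n
      D⁺ r = D r ⊎ r ≡ w
      F = insertAt p w E
      D⁺-domain : IsDomain D⁺
      D⁺-domain r (inj₁ d) = isD r d
      D⁺-domain r (inj₂ refl) = w-linear
      F-in-D⁺ : ∀ j → j < suc m → D⁺ (F j)
      F-in-D⁺ j j≤m with <-cmp j p
      ... | tri< j<p _ _ = inj₁ (E-in-D (<-≤-trans j<p p≤m))
      ... | tri≈ _ _ _ = inj₂ refl
      ... | tri> _ _ p<j = inj₁ (E-in-D (pred< p<j (≤-pred j≤m)))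
      F-onto : ∀ r → D⁺ r → ∃ λ j → j < suc m × F j ≡ r
      F-onto r (inj₂ refl) = p , s≤s p≤m , insertAt-at {p = p} {F = E}
      F-onto r (inj₁ d) with E-onto r d
      ... | j , j<m , Ej≡r with <-cmp j p
      ...   | tri< j<p _ _ = j , m≤n⇒m≤1+n j<m , trans (insertAt-below {F = E} j<p) Ej≡r
      ...   | tri≈ _ refl _ = suc j , s≤s j<m , trans (insertAt-above {w = w} {F = E} ≤-refl) Ej≡r
      ...   | tri> _ _ p<j = suc j , s≤s j<m , trans (insertAt-above {w = w} {F = E} (m≤n⇒m≤1+n p<j)) Ej≡r
      D⁺-single-crossing : IsSingleCrossing D⁺
      D⁺-single-crossing = D⁺-domain , suc m , (λ i → F (toℕ i)) ,
        sequence-enumeration D⁺ (suc m) F (insertAt-injective p≤m E-injective new) F-in-D⁺ F-onto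
          (λ x y x≢y → insertAt-interval (λ r → Above r x y) p≤m (E-interval x y x≢y) (fits x y x≢y))
    ... | j , j<m , Ej≡w = new j j<m Ej≡w

module MaximalChain (D : Domain n) (isD : IsDomain D) (m : ℕ) (e : Fin m → Order n) (sc : IsSCEnumeration D m e)
  (maximal : ∀ (D' : Domain n) → IsSingleCrossing D' → D ⊆D D' → D' ⊆D D) where

  open Chain D isD m e sc public
  open Maximal maximal public

  -- The chain is not empty: otherwise any linear order could be added to D.
  chain-nonempty : 0 < m
  chain-nonempty with 0 <? m
  ... | yes 0<m = 0<m
  ... | no 0≮m = ⊥-elim (no-insertion (allFin n) z≤n (allFin⁺ n , ∈-allFin) (λ j j<m _ → 0≮m (≤-<-trans z≤n j<m))
                   (λ _ _ _ → fresh-last (sym (n≤0⇒n≡0 (≮⇒≥ 0≮m))) (λ _ j j<m _ → 0≮m (≤-<-trans z≤n j<m))))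

  last : ℕ
  last = pred m

  last<m : last < m
  last<m = pred< chain-nonempty ≤-refl

  no-order-between : ∀ {j} → suc j < m → (w : Order n) → IsLinOrd w → w ≢ E j → w ≢ E (suc j) →
    (∀ x y → Above (E j) x y → Above (E (suc j)) x y → Above w x y) → ⊥
  no-order-between {j} j+1<m w w-lin w≢Eⱼ w≢Eⱼ₊₁ between = no-insertion w (<⇒≤ j+1<m) w-lin new fits
    where
    j<m = <-trans (n<1+n j) j+1<m
    one-of : ∀ {x y} → Above w x y → Above (E j) x y ⊎ Above (E (suc j)) x y
    one-of {x} {y} xy with Above? (E j) x y | Above? (E (suc j)) x y
    ... | yes xyʲ | _ = inj₁ xyʲ
    ... | no _ | yes xyʲ⁺¹ = inj₂ xyʲ⁺¹
    ... | no ¬xyʲ | no ¬xyʲ⁺¹ = ⊥-elim (Above-asym (proj₁ w-lin) xy (between y x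
          (Above-flip (E-linear j<m) x≢y ¬xyʲ) (Above-flip (E-linear j+1<m) x≢y ¬xyʲ⁺¹)))
      where x≢y = Above-≢ (proj₁ w-lin) xy
    fits : ∀ x y → x ≢ y → Fits m (suc j) (λ l → Above (E l) x y) (Above w x y)
    fits x y _ with agrees-with-one (Above? w x y) (Above? (E j) x y) (Above? (E (suc j)) x y) (between x y) one-of
    ... | inj₁ like-Eⱼ = like-left (s≤s z≤n) like-Eⱼ
    ... | inj₂ like-Eⱼ₊₁ = like-right j+1<m like-Eⱼ₊₁
    new : ∀ l → l < m → E l ≢ w
    new l l<m Eₗ≡w with <-cmp l j | <-cmp l (suc j)
    ... | tri≈ _ refl _ | _ = w≢Eⱼ (sym Eₗ≡w)
    ... | _ | tri≈ _ refl _ = w≢Eⱼ₊₁ (sym Eₗ≡w)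
    ... | tri< l<j _ _ | _ with distinct-orders-disagree w-lin (E-linear j<m) w≢Eⱼ
    ...   | x , y , xyʷ , yxʲ with one-of xyʷ
    ...     | inj₁ xyʲ = Above-asym (E-unique j<m) xyʲ yxʲ
    ...     | inj₂ xyʲ⁺¹ = Above-asym (E-unique j<m)
                (E-between (<⇒≤ l<j) (n≤1+n j) j+1<m (subst (λ r → Above r x y) (sym Eₗ≡w) xyʷ) xyʲ⁺¹) yxʲ
    new l l<m Eₗ≡w | _ | tri> _ _ j+1<l with distinct-orders-disagree w-lin (E-linear j+1<m) w≢Eⱼ₊₁
    ...   | x , y , xyʷ , yxʲ⁺¹ with one-of xyʷ
    ...     | inj₂ xyʲ⁺¹ = Above-asym (E-unique j+1<m) xyʲ⁺¹ yxʲ⁺¹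
    ...     | inj₁ xyʲ = Above-asym (E-unique j+1<m)
                (E-between (n≤1+n j) (<⇒≤ j+1<l) l<m xyʲ (subst (λ r → Above r x y) (sym Eₗ≡w) xyʷ)) yxʲ⁺¹
    new l l<m Eₗ≡w | tri> _ _ j<l | tri< l<j+1 _ _ = <⇒≱ j<l (≤-pred l<j+1)

  record Step (j : ℕ) : Set where
    field
      upper lower : Fin n
      adjacent : Consec (E j) upper lower
      next : transpose adjacent ≡ E (suc j)

  -- Some adjacent pair of E j is reversed in E (j + 1); exchanging it gives an
  -- order between the two, which must therefore be E (j + 1) itself.
  step : ∀ {j} → suc j < m → Step j
  step {j} j+1<m with refines-or-violation (Above (E (suc j))) (Above? (E (suc j))) Above-trans (E j)
  ... | inj₁ refines = ⊥-elim (<⇒≢ (n<1+n j)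
        (E-injective j (suc j) j<m j+1<m (sym (linear-ext (E-linear j+1<m) (E-linear j<m) refines))))
    where j<m = <-trans (n<1+n j) j+1<m
  ... | inj₂ (a , b , c , ¬abʲ⁺¹) = record { upper = a ; lower = b ; adjacent = c ; next = next }
    where
    j<m = <-trans (n<1+n j) j+1<m
    abʲ = Consec⇒Above (E-unique j<m) c
    ≢Eⱼ : transpose c ≢ E j
    ≢Eⱼ eq = Above-asym (E-unique j<m) abʲ (subst (λ r → Above r b a) eq (transpose-flips (E-unique j<m) c))
    between : ∀ x y → Above (E j) x y → Above (E (suc j)) x y → Above (transpose c) x y
    between x y xyʲ xyʲ⁺¹ = transpose-keeps (E-unique j<m) c other xyʲ
      where
      other : ¬ SamePair a b x y
      other (inj₁ (refl , refl)) = ¬abʲ⁺¹ xyʲ⁺¹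
      other (inj₂ (refl , refl)) = Above-asym (E-unique j<m) abʲ xyʲ
    next : transpose c ≡ E (suc j)
    next with ≡-dec _≟ᶠ_ (transpose c) (E (suc j))
    ... | yes eq = eq
    ... | no ≢Eⱼ₊₁ =
      ⊥-elim (no-order-between j+1<m (transpose c) (transpose-linear (E-linear j<m) c) ≢Eⱼ ≢Eⱼ₊₁ between)

  -- The step from E j to E (j + 1), with its consequences.  The bound is
  -- irrelevant, so that the step does not depend on how it was established.
  module Step-at {j} .(j+1<m′ : suc j < m) where

    j+1<m : suc j < m
    j+1<m = recompute (suc j <? m) j+1<m′

    j<m : j < m
    j<m = <-trans (n<1+n j) j+1<m

    open Step (step j+1<m) public

    keeps : ∀ {p q} → ¬ SamePair upper lower p q → Above (E j) p q → Above (E (suc j)) p q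
    keeps other pq = subst (λ r → Above r _ _) next (transpose-keeps (E-unique j<m) adjacent other pq)

    reflects : ∀ {p q} → ¬ SamePair upper lower p q → Above (E (suc j)) p q → Above (E j) p q
    reflects other pq = transpose-reflects (E-linear j<m) adjacent other (subst (λ r → Above r _ _) (sym next) pq)

    upper-above : Above (E j) upper lower
    upper-above = Consec⇒Above (E-unique j<m) adjacent

    adjacent-after : Consec (E (suc j)) lower upper
    adjacent-after = subst (λ r → Consec r lower upper) next (transpose-consec adjacent)

    lower-above : Above (E (suc j)) lower upper
    lower-above = Consec⇒Above (E-unique j+1<m) adjacent-after

    switch-unique : ∀ {x y} → Above (E j) x y → Above (E (suc j)) y x → x ≡ upper × y ≡ lower
    switch-unique {x} {y} xyʲ yxʲ⁺¹ with samePair? upper lower x y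
    ... | yes (inj₁ same) = same
    ... | yes (inj₂ (refl , refl)) = ⊥-elim (Above-asym (E-unique j<m) upper-above xyʲ)
    ... | no other = ⊥-elim (Above-asym (E-unique j+1<m) (keeps other xyʲ) yxʲ⁺¹)

  -- The last order of the chain reverses the first one: otherwise a reversed
  -- pair could still be exchanged in a new last order.
  last-reverses-first : ∀ {x y} → Above (E 0) x y → Above (E last) y x
  last-reverses-first {x} {y} xy⁰
    with refines-or-violation (λ p q → Above (E 0) q p) (λ p q → Above? (E 0) q p) (λ qp rq → Above-trans rq qp) (E last)
  ... | inj₁ reverses = Above-flip (E-linear last<m) (Above-≢ (E-unique chain-nonempty) xy⁰)
                          (λ xyˡ → Above-asym (E-unique chain-nonempty) xy⁰ (reverses x y xyˡ))
  ... | inj₂ (a , b , c , ¬ba⁰) = ⊥-elim (no-insertion (transpose c) ≤-refl (transpose-linear (E-linear last<m) c) new fits)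
    where
    abˡ = Consec⇒Above (E-unique last<m) c
    ab⁰ = Above-flip (E-linear chain-nonempty) (λ b≡a → Above-≢ (E-unique last<m) abˡ (sym b≡a)) ¬ba⁰
    ab-everywhere : ∀ l → l < m → Above (E l) a b
    ab-everywhere l l<m = E-between z≤n (<⇒≤pred l<m) last<m ab⁰ abˡ
    baᵗ : Above (transpose c) b a
    baᵗ = transpose-flips (E-unique last<m) c
    new : ∀ l → l < m → E l ≢ transpose c
    new l l<m eq = Above-asym (E-unique l<m) (ab-everywhere l l<m) (subst (λ r → Above r b a) (sym eq) baᵗ)
    fits : ∀ x y → x ≢ y → Fits m m (λ l → Above (E l) x y) (Above (transpose c) x y)
    fits x y _ with samePair? a b x y
    ... | yes (inj₁ (refl , refl)) =
      fresh-last refl (λ abᵗ → ⊥-elim (Above-asym (transpose-unique (E-unique last<m) c) abᵗ baᵗ))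
    ... | yes (inj₂ (refl , refl)) =
      fresh-last refl (λ _ l l<m baˡ → Above-asym (E-unique l<m) (ab-everywhere l l<m) baˡ)
    ... | no other = like-left chain-nonempty
      (mk⇔ (transpose-reflects (E-linear last<m) c other) (transpose-keeps (E-unique last<m) c other))

  record SwitchTime (x y : Fin n) : Set where
    field
      τ : ℕ
      τ+1<m : suc τ < m
      upper≡x : Step-at.upper τ+1<m ≡ x
      lower≡y : Step-at.lower τ+1<m ≡ y
      before : ∀ j → j ≤ τ → Above (E j) x y
      after : ∀ j → suc τ ≤ j → j < m → Above (E j) y x

  switch-time : ∀ {x y} → Above (E 0) x y → SwitchTime x y
  switch-time {x} {y} xy⁰ with crossing (λ j → Above (E j) x y) (λ j → Above? (E j) x y) last xy⁰
                                 (λ xyˡ → Above-asym (E-unique last<m) xyˡ (last-reverses-first xy⁰))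
  ... | τ , τ+1≤last , xyᵗ , ¬xyᵗ⁺¹ = record
    { τ = τ ; τ+1<m = τ+1<m ; upper≡x = sym (proj₁ switched) ; lower≡y = sym (proj₂ switched)
    ; before = λ j j≤τ → E-between z≤n j≤τ (<-trans (n<1+n τ) τ+1<m) xy⁰ xyᵗ
    ; after = λ j τ<j j<m → E-between τ<j (<⇒≤pred j<m) last<m yxᵗ⁺¹ (last-reverses-first xy⁰)
    }
    where
    τ+1<m = ≤-<-trans τ+1≤last last<m
    yxᵗ⁺¹ = Above-flip (E-linear τ+1<m) (Above-≢ (E-unique chain-nonempty) xy⁰) ¬xyᵗ⁺¹
    switched = Step-at.switch-unique τ+1<m xyᵗ yxᵗ⁺¹

  module Steps {t} (t+2<m : suc (suc t) < m) where
    t+1<m : suc t < m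
    t+1<m = <-trans (n<1+n _) t+2<m
    t<m : t < m
    t<m = <-trans (n<1+n _) t+1<m
    module S₁ = Step-at t+1<m
    module S₂ = Step-at t+2<m
    open S₁ public using () renaming (upper to a; lower to b)
    open S₂ public using () renaming (upper to u; lower to v)

    no-undo : u ≡ b → v ≡ a → ⊥
    no-undo u≡b v≡a = Above-asym (E-unique t+1<m)
      (E-between (n≤1+n t) (n≤1+n (suc t)) t+2<m S₁.upper-above (subst₂ (Above (E (suc (suc t)))) v≡a u≡b S₂.lower-above))
      S₁.lower-above

    -- Hence the steps cannot meet in the middle: b is immediately above a in
    -- E (t + 1), so u = b would force v = a, and v = a would force u = b.
    not-upper-lower : u ≡ b → ⊥
    not-upper-lower u≡b = no-undo u≡b (sym (Consec-successor-unique (E-unique t+1<m) S₁.adjacent-after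
                            (subst (λ w → Consec (E (suc t)) w v) u≡b S₂.adjacent)))

    not-lower-upper : v ≡ a → ⊥
    not-lower-upper v≡a = no-undo (sym (Consec-predecessor-unique (E-unique t+1<m) S₁.adjacent-after
                            (subst (Consec (E (suc t)) u) v≡a S₂.adjacent))) v≡a

  InStep : ∀ {j} → .(suc j < m) → Fin n → Set
  InStep j+1<m z = z ≡ Step-at.upper j+1<m ⊎ z ≡ Step-at.lower j+1<m

  module _ {j} .(j+1<m : suc j < m) {z : Fin n} where
    open Step-at j+1<m using (upper; lower; upper-above; lower-above; switch-unique)

    InStep⇒InSwitchingPair : InStep j+1<m z → InSwitchingPair (E j) (E (suc j)) z
    InStep⇒InSwitchingPair (inj₁ refl) = lower , inj₁ (Above⇒above upper-above , Above⇒above lower-above)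
    InStep⇒InSwitchingPair (inj₂ refl) = upper , inj₂ (Above⇒above upper-above , Above⇒above lower-above)

    InSwitchingPair⇒InStep : InSwitchingPair (E j) (E (suc j)) z → InStep j+1<m z
    InSwitchingPair⇒InStep (u , inj₁ (zu , uz)) = inj₁ (proj₁ (switch-unique (above⇒Above _ _ _ zu) (above⇒Above _ _ _ uz)))
    InSwitchingPair⇒InStep (u , inj₂ (uz , zu)) = inj₂ (proj₂ (switch-unique (above⇒Above _ _ _ uz) (above⇒Above _ _ _ zu)))

  Concatenated : Set
  Concatenated = ∀ {j} (j+2<m : suc (suc j) < m) → ∃ λ z → InStep (<-trans (n<1+n _) j+2<m) z × InStep j+2<m z

  concatenated⇔ : PairwiseConcatenation m e ⇔ Concatenated
  concatenated⇔ = mk⇔ to from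
    where
    along : ∀ {r₁ r₂ r₃ r₁′ r₂′ r₃′} {z : Fin n} → r₁ ≡ r₁′ → r₂ ≡ r₂′ → r₃ ≡ r₃′ →
      InSwitchingPair r₁ r₂ z × InSwitchingPair r₂ r₃ z → InSwitchingPair r₁′ r₂′ z × InSwitchingPair r₂′ r₃′ z
    along refl refl refl pairs = pairs
    to : PairwiseConcatenation m e → Concatenated
    to pc {j} j+2<m with along (sym (E-fromℕ< j<m)) (sym (E-fromℕ< j+1<m)) (sym (E-fromℕ< j+2<m)) (proj₂ shared)
      where
      j+1<m = <-trans (n<1+n _) j+2<m
      j<m = <-trans (n<1+n _) j+1<m
      shared = pc (fromℕ< j<m) (fromℕ< j+1<m) (fromℕ< j+2<m)
                 (trans (toℕ-fromℕ< j+1<m) (cong suc (sym (toℕ-fromℕ< j<m))))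
                 (trans (toℕ-fromℕ< j+2<m) (cong suc (sym (toℕ-fromℕ< j+1<m))))
    ... | inᵢⱼ , inⱼₖ = _ , InSwitchingPair⇒InStep _ inᵢⱼ , InSwitchingPair⇒InStep _ inⱼₖ
    from : Concatenated → PairwiseConcatenation m e
    from concatenated i j k j≡i+1 k≡j+1 with concatenated t+2<m
      where
      t+2<m : suc (suc (toℕ i)) < m
      t+2<m = subst (_< m) (trans k≡j+1 (cong suc j≡i+1)) (toℕ<n k)
    ... | z , in₁ , in₂ = z , along (E-toℕ i) (trans (cong E (sym j≡i+1)) (E-toℕ j))
                                     (trans (cong E (sym (trans k≡j+1 (cong suc j≡i+1)))) (E-toℕ k))
                                     (InStep⇒InSwitchingPair _ in₁ , InStep⇒InSwitchingPair _ in₂)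

module ConcatenationSuffices (D : Domain n) (isD : IsDomain D) (m : ℕ) (e : Fin m → Order n) (sc : IsSCEnumeration D m e)
  (maximal : ∀ (D' : Domain n) → IsSingleCrossing D' → D ⊆D D' → D' ⊆D D) where
  open MaximalChain D isD m e sc maximal

  module _ (concatenated : Concatenated) {D' : Domain n} (condorcet' : IsCondorcet D') (D⊆D' : D ⊆D D')
    {r : Order n} (r∈D' : D' r) (r-new : ∀ j → j < m → E j ≢ r) where

    private
      r-linear : IsLinOrd r
      r-linear = proj₁ condorcet' r r∈D'

    Follows Resists : ∀ {t} → .(suc t < m) → Set
    Follows t+1<m = Above r (Step-at.lower t+1<m) (Step-at.upper t+1<m)
    Resists t+1<m = Above r (Step-at.upper t+1<m) (Step-at.lower t+1<m)

    follows-or-resists : ∀ {t} .(t+1<m : suc t < m) → Follows t+1<m ⊎ Resists t+1<m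
    follows-or-resists t+1<m with Above? r (Step-at.lower t+1<m) (Step-at.upper t+1<m)
    ... | yes follows = inj₁ follows
    ... | no ¬follows = inj₂ (Above-flip r-linear (λ l≡u → Above-≢ (E-unique S.j<m) S.upper-above (sym l≡u)) ¬follows)
      where module S = Step-at t+1<m

    module _ {t} (t+2<m : suc (suc t) < m) (abʳ : Resists (<-trans (n<1+n _) t+2<m)) (vuʳ : Follows t+2<m) where
      open Steps t+2<m

      private
        Eₜ∈D' = D⊆D' _ (E-in-D t<m)
        Eₜ₊₂∈D' = D⊆D' _ (E-in-D t+2<m)

      -- If the second step moves a further down (u = a), then a>b, b>v, v>a
      -- each hold in two of E t, r and E (t + 2).
      cycle-upper : u ≡ a → ⊥
      cycle-upper u≡a = condorcet-cycle condorcet' Eₜ∈D' r∈D' Eₜ₊₂∈D' S₁.upper-above abʳ bvᵗ bv² vaʳ va²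
        where
        av¹ = subst (λ w → Above (E (suc t)) w v) u≡a S₂.upper-above
        bv¹ = Above-trans S₁.lower-above av¹
        b≢a = Above-≢ (E-unique t+1<m) S₁.lower-above
        bvᵗ = S₁.reflects (λ { (inj₁ (b≡a , _)) → b≢a b≡a
                             ; (inj₂ (_ , v≡a)) → Above-≢ (E-unique t+1<m) av¹ (sym v≡a) }) bv¹
        bv² = S₂.keeps (λ { (inj₁ (b≡u , _)) → b≢a (trans b≡u u≡a)
                          ; (inj₂ (b≡v , _)) → Above-≢ (E-unique t+1<m) bv¹ b≡v }) bv¹
        va² = subst (Above (E (suc (suc t))) v) u≡a S₂.lower-above
        vaʳ = subst (Above r v) u≡a vuʳ

      -- If the second step moves b further up (v = b), then u>a, a>b, b>u
      -- each hold in two of E t, E (t + 2) and r.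
      cycle-lower : v ≡ b → ⊥
      cycle-lower v≡b = condorcet-cycle condorcet' Eₜ∈D' Eₜ₊₂∈D' r∈D' uaᵗ ua² S₁.upper-above abʳ bu² buʳ
        where
        ub¹ = subst (Above (E (suc t)) u) v≡b S₂.upper-above
        ua¹ = Above-trans ub¹ S₁.lower-above
        a≢b = Above-≢ (E-unique t<m) S₁.upper-above
        uaᵗ = S₁.reflects (λ { (inj₁ (u≡a , _)) → Above-≢ (E-unique t+1<m) ua¹ u≡a
                             ; (inj₂ (u≡b , _)) → Above-≢ (E-unique t+1<m) ub¹ u≡b }) ua¹
        ua² = S₂.keeps (λ { (inj₁ (_ , a≡v)) → a≢b (trans a≡v v≡b)
                          ; (inj₂ (u≡v , _)) → Above-≢ (E-unique t+1<m) S₂.upper-above u≡v }) ua¹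
        bu² = subst (λ w → Above (E (suc (suc t))) w u) v≡b S₂.lower-above
        buʳ = subst (λ w → Above r w u) v≡b vuʳ

    -- r cannot resist a step and follow the next one: the two steps share an
    -- alternative, which closes a Condorcet cycle or contradicts adjacency.
    no-resist-then-follow : ∀ {t} (t+2<m : suc (suc t) < m) → Resists (<-trans (n<1+n _) t+2<m) → Follows t+2<m → ⊥
    no-resist-then-follow t+2<m abʳ vuʳ with concatenated t+2<m
    ... | _ , inj₁ refl , inj₁ a≡u = cycle-upper t+2<m abʳ vuʳ (sym a≡u)
    ... | _ , inj₂ refl , inj₂ b≡v = cycle-lower t+2<m abʳ vuʳ (sym b≡v)
    ... | _ , inj₁ refl , inj₂ a≡v = Steps.not-lower-upper t+2<m (sym a≡v)
    ... | _ , inj₂ refl , inj₁ b≡u = Steps.not-upper-lower t+2<m (sym b≡u)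

    private
      no-follow-after-resist : ∀ {s k} → s < k → (∀ t .(t+1<m : suc t < m) → s ≤ t → t < k → Resists t+1<m) →
        (k+1<m : suc k < m) → Follows k+1<m → ⊥
      no-follow-after-resist {k = suc k} s<k+1 resist k+2<m follows =
        no-resist-then-follow k+2<m (resist k _ (≤-pred s<k+1) ≤-refl) follows

    threshold : ∀ k → k ≤ last → ∃ λ s → s ≤ k ×
      (∀ t .(t+1<m : suc t < m) → t < s → Follows t+1<m) × (∀ t .(t+1<m : suc t < m) → s ≤ t → t < k → Resists t+1<m)
    threshold zero _ = 0 , z≤n , (λ _ _ ()) , (λ _ _ _ ())
    threshold (suc k) k+1≤last with threshold k (≤-trans (n≤1+n k) k+1≤last) | follows-or-resists k+1<m
      where
      k+1<m : suc k < m
      k+1<m = ≤-<-trans k+1≤last last<m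
    ... | s , s≤k , follow , resist | inj₂ resistsₖ = s , m≤n⇒m≤1+n s≤k , follow , resist′
      where
      resist′ : ∀ t .(t+1<m : suc t < m) → s ≤ t → t < suc k → Resists t+1<m
      resist′ t t+1<m s≤t t<k+1 with m≤n⇒m<n∨m≡n (≤-pred t<k+1)
      ... | inj₁ t<k = resist t t+1<m s≤t t<k
      ... | inj₂ refl = resistsₖ
    ... | s , s≤k , follow , resist | inj₁ followsₖ with m≤n⇒m<n∨m≡n s≤k
    ...   | inj₁ s<k = ⊥-elim (no-follow-after-resist s<k resist (≤-<-trans k+1≤last last<m) followsₖ)
    ...   | inj₂ refl = suc s , ≤-refl , follow′ , λ _ _ s+1≤t t<s+1 → ⊥-elim (<⇒≱ t<s+1 s+1≤t)
      where
      follow′ : ∀ t .(t+1<m : suc t < m) → t < suc s → Follows t+1<m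
      follow′ t t+1<m t<s+1 with m≤n⇒m<n∨m≡n (≤-pred t<s+1)
      ... | inj₁ t<s = follow t t+1<m t<s
      ... | inj₂ refl = followsₖ

    -- If r follows the steps before s and resists those from s on, then r
    -- ranks every pair as E s does: a pair is exchanged by a step before s
    -- exactly when E s ranks it reversed with respect to E 0.
    module _ {s} (s<m : s < m) (follow : ∀ t .(t+1<m : suc t < m) → t < s → Follows t+1<m)
      (resist : ∀ t .(t+1<m : suc t < m) → s ≤ t → t < last → Resists t+1<m) where

      private
        resisted-pair : ∀ {x y} → Above (E 0) x y → Above (E s) x y → Above r x y
        resisted-pair {x} {y} xy⁰ xyˢ = by-time (s ≤? τ)
          where
          open SwitchTime (switch-time xy⁰)
          by-time : Dec (s ≤ τ) → Above r x y
          by-time (yes s≤τ) = subst₂ (Above r) upper≡x lower≡y (resist τ τ+1<m s≤τ (<⇒≤pred τ+1<m))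
          by-time (no s≰τ) = ⊥-elim (Above-asym (E-unique s<m) xyˢ (after s (≰⇒> s≰τ) s<m))

        followed-pair : ∀ {x y} → Above (E 0) y x → Above (E s) x y → Above r x y
        followed-pair {x} {y} yx⁰ xyˢ = by-time (s ≤? τ)
          where
          open SwitchTime (switch-time yx⁰)
          by-time : Dec (s ≤ τ) → Above r x y
          by-time (yes s≤τ) = ⊥-elim (Above-asym (E-unique s<m) xyˢ (before s s≤τ))
          by-time (no s≰τ) = subst₂ (Above r) lower≡y upper≡x (follow τ τ+1<m (≰⇒> s≰τ))

      agrees-at-threshold : ∀ x y → Above (E s) x y → Above r x y
      agrees-at-threshold x y xyˢ with Above? (E 0) x y
      ... | yes xy⁰ = resisted-pair xy⁰ xyˢ
      ... | no ¬xy⁰ = followed-pair (Above-flip (E-linear chain-nonempty) (Above-≢ (E-unique s<m) xyˢ) ¬xy⁰) xyˢ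

    no-outside-order : ⊥
    no-outside-order with threshold last ≤-refl
    ... | s , s≤last , follow , resist =
      r-new s s<m (sym (linear-ext r-linear (E-linear s<m) (agrees-at-threshold s<m follow resist)))
      where s<m = ≤-<-trans s≤last last<m

  concatenated⇒maximal : Concatenated → IsMaximalCondorcet D
  concatenated⇒maximal concatenated = chain-condorcet , extension-inside
    where
    extension-inside : ∀ D' → IsCondorcet D' → D ⊆D D' → D' ⊆D D
    extension-inside D' condorcet' D⊆D' r r∈D' with any? (λ i → ≡-dec _≟ᶠ_ (e i) r)
    ... | yes (i , eᵢ≡r) = subst D eᵢ≡r (proj₁ (proj₂ sc) i)
    ... | no r∉e = ⊥-elim (no-outside-order concatenated condorcet' D⊆D' r∈D' r-new)
      where
      r-new : ∀ j → j < m → E j ≢ r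
      r-new j j<m Eⱼ≡r = r∉e (fromℕ< j<m , trans (sym (E-fromℕ< j<m)) Eⱼ≡r)

module ConcatenationNecessary (D : Domain n) (isD : IsDomain D) (m : ℕ) (e : Fin m → Order n) (sc : IsSCEnumeration D m e)
  (maximal : ∀ (D' : Domain n) → IsSingleCrossing D' → D ⊆D D' → D' ⊆D D)
  (maximalᶜ : ∀ (D' : Domain n) → IsCondorcet D' → D ⊆D D' → D' ⊆D D)
  {t} (t+2<m : suc (suc t) < m) where
  open MaximalChain D isD m e sc maximal
  open Steps t+2<m

  -- Two consecutive steps exchanging disjoint pairs {a , b} and {u , v}
  -- commute: exchanging u and v first gives a new order R′, and D with R′
  -- added is still a Condorcet domain, contradicting maximality.
  module _ (u≢a : u ≢ a) (u≢b : u ≢ b) (v≢a : v ≢ a) (v≢b : v ≢ b) where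

    private
      Eₜ-unique = E-unique t<m
      Eₜ₊₁-unique = E-unique t+1<m
      Eₜ₊₂-unique = E-unique t+2<m

      not-ab : ∀ {x y} → x ≢ a → x ≢ b → ¬ SamePair a b x y
      not-ab x≢a _ (inj₁ (x≡a , _)) = x≢a x≡a
      not-ab _ x≢b (inj₂ (x≡b , _)) = x≢b x≡b

      not-uv : ∀ {x y} → x ≢ u → x ≢ v → ¬ SamePair u v x y
      not-uv x≢u _ (inj₁ (x≡u , _)) = x≢u x≡u
      not-uv _ x≢v (inj₂ (x≡v , _)) = x≢v x≡v

      flip-not : ∀ {p q x y : Fin n} → ¬ SamePair p q x y → ¬ SamePair p q y x
      flip-not other same = other (SamePair-flip same)

    -- u is immediately above v already in E t: anything between them would
    -- still lie between them in E (t + 1).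
    uv-adjacent : Consec (E t) u v
    uv-adjacent = nothing-between⇒Consec Eₜ-unique uvᵗ empty
      where
      uvᵗ = S₁.reflects (not-ab u≢a u≢b) S₂.upper-above
      empty : ∀ z → ¬ Between (E t) u z v
      empty z (uz , zv) = Consec⇒nothing-between Eₜ₊₁-unique S₂.adjacent z
        (S₁.keeps (not-ab u≢a u≢b) uz , S₁.keeps (flip-not (not-ab v≢a v≢b)) zv)

    -- E t with u and v exchanged: the two steps performed in the other order.
    R′ : Order n
    R′ = transpose uv-adjacent

    R′-linear : IsLinOrd R′
    R′-linear = transpose-linear (E-linear t<m) uv-adjacent

    R′-unique : Unique R′
    R′-unique = proj₁ R′-linear

    vuᴿ : Above R′ v u
    vuᴿ = transpose-flips Eₜ-unique uv-adjacent

    abᴿ : Above R′ a b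
    abᴿ = transpose-keeps Eₜ-unique uv-adjacent
            (not-uv (λ a≡u → u≢a (sym a≡u)) (λ a≡v → v≢a (sym a≡v))) S₁.upper-above

    Other : Fin n → Fin n → Set
    Other x y = ¬ SamePair a b x y × ¬ SamePair u v x y

    R′⇒Eₜ₊₁ : ∀ {x y} → Other x y → Above R′ x y → Above (E (suc t)) x y
    R′⇒Eₜ₊₁ (not-ab , not-uv) xy = S₁.keeps not-ab (transpose-reflects (E-linear t<m) uv-adjacent not-uv xy)

    Eₜ₊₁⇒R′ : ∀ {x y} → Other x y → Above (E (suc t)) x y → Above R′ x y
    Eₜ₊₁⇒R′ (not-ab , not-uv) xy = transpose-keeps Eₜ-unique uv-adjacent not-uv (S₁.reflects not-ab xy)

    -- R′ is not in the chain: it ranks v above u, as only the orders from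
    -- E (t + 2) on do, and a above b, as only the orders up to E t do.
    R′-new : ∀ l → l < m → E l ≢ R′
    R′-new l l<m Eₗ≡R′ with l ≤? t
    ... | yes l≤t = Above-asym Eₜ-unique (S₁.reflects (not-ab u≢a u≢b) S₂.upper-above)
          (E-between l≤t (≤-trans (n≤1+n t) (n≤1+n (suc t))) t+2<m
            (subst (λ r → Above r v u) (sym Eₗ≡R′) vuᴿ) S₂.lower-above)
    ... | no l≰t = Above-asym Eₜ₊₁-unique
          (E-between (n≤1+n t) (≰⇒> l≰t) l<m S₁.upper-above (subst (λ r → Above r a b) (sym Eₗ≡R′) abᴿ))
          S₁.lower-above

    D⁺ : Domain n
    D⁺ r = D r ⊎ r ≡ R′

    D⁺-domain : IsDomain D⁺
    D⁺-domain r (inj₁ d) = isD r d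
    D⁺-domain r (inj₂ refl) = R′-linear

    data Reading (j : ℕ) (x y : Fin n) : Set where
      in-chain : Above (E j) x y → Reading j x y
      as-R′ : j ≡ suc t → Above R′ x y → Reading j x y

    witness-before : ∀ {τ j x y} → τ ≢ suc t ⊎ Other x y → j ≤ τ → Reading j x y →
      ∃ λ i → i ≤ τ × Above (E i) x y
    witness-before _ j≤τ (in-chain xy) = _ , j≤τ , xy
    witness-before (inj₂ other) j≤τ (as-R′ refl xy) = suc t , j≤τ , R′⇒Eₜ₊₁ other xy
    witness-before {x = x} {y} (inj₁ τ≢t+1) t+1≤τ (as-R′ refl xy) with samePair? u v x y
    ... | no not-uv = t , ≤-trans (n≤1+n t) t+1≤τ , transpose-reflects (E-linear t<m) uv-adjacent not-uv xy
    ... | yes (inj₁ (refl , refl)) = ⊥-elim (Above-asym R′-unique xy vuᴿ)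
    ... | yes (inj₂ (refl , refl)) = suc (suc t) , ≤∧≢⇒< t+1≤τ (λ t+1≡τ → τ≢t+1 (sym t+1≡τ)) , S₂.lower-above

    witness-after : ∀ {τ j x y} → τ ≢ suc t ⊎ Other x y → τ ≤ j → j < m → Reading j x y →
      ∃ λ i → τ ≤ i × i < m × Above (E i) x y
    witness-after _ τ≤j j<m (in-chain xy) = _ , τ≤j , j<m , xy
    witness-after (inj₂ other) τ≤j _ (as-R′ refl xy) = suc t , τ≤j , t+1<m , R′⇒Eₜ₊₁ other xy
    witness-after {x = x} {y} (inj₁ τ≢t+1) τ≤t+1 _ (as-R′ refl xy) with samePair? u v x y
    ... | no not-uv = t , ≤-pred (≤∧≢⇒< τ≤t+1 τ≢t+1) , t<m , transpose-reflects (E-linear t<m) uv-adjacent not-uv xy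
    ... | yes (inj₁ (refl , refl)) = ⊥-elim (Above-asym R′-unique xy vuᴿ)
    ... | yes (inj₂ (refl , refl)) = suc (suc t) , ≤-trans τ≤t+1 (n≤1+n _) , t+2<m , S₂.lower-above

    module Profile {k} (P : Fin k → Order n) (inD⁺ : ∀ w → D⁺ (P w)) where

      placement : ∀ w → Σ ℕ λ j → j < m × (E j ≡ P w ⊎ (P w ≡ R′ × j ≡ suc t))
      placement w with inD⁺ w
      ... | inj₁ d = let (j , j<m , Eⱼ≡) = E-onto _ d in j , j<m , inj₁ Eⱼ≡
      ... | inj₂ ≡R′ = suc t , t+1<m , inj₂ (≡R′ , refl)

      pos : Fin k → ℕ
      pos w = proj₁ (placement w)

      pos<m : ∀ w → pos w < m
      pos<m w = proj₁ (proj₂ (placement w))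

      read : ∀ w {x y} → above (P w) x y ≡ true → Reading (pos w) x y
      read w {x} {y} xy with placement w
      ... | _ , _ , inj₁ Eⱼ≡ = in-chain (subst (λ r → Above r x y) (sym Eⱼ≡) (above⇒Above _ x y xy))
      ... | _ , _ , inj₂ (≡R′ , j≡) = as-R′ j≡ (subst (λ r → Above r x y) ≡R′ (above⇒Above _ x y xy))

      M = Majority k P

      M? : ∀ x y → Dec (M x y)
      M? x y = k <? 2 * count k (λ w → above (P w) x y)

      M-asym : ∀ {x y} → M x y → M y x → ⊥
      M-asym {x} {y} mxy myx with majorities-intersect k _ _ mxy myx
      ... | w , xy , yx = Above-asym (proj₁ (D⁺-domain _ (inD⁺ w))) (above⇒Above _ x y xy) (above⇒Above _ y x yx)

      module _ {τ} (median : ∀ (f : Fin k → Bool) → k < 2 * count k f →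
                     (∃ λ w → f w ≡ true × pos w ≤ τ) × (∃ λ w → f w ≡ true × τ ≤ pos w)) where

        majority-at-median : ∀ {x y} → τ ≢ suc t ⊎ Other x y → M x y → Above (E τ) x y
        majority-at-median away mxy with median _ mxy
        ... | (w₁ , xy₁ , w₁≤τ) , (w₂ , xy₂ , τ≤w₂) with witness-before away w₁≤τ (read w₁ xy₁)
                                                      | witness-after away τ≤w₂ (pos<m w₂) (read w₂ xy₂)
        ...   | i₁ , i₁≤τ , xyⁱ¹ | i₂ , τ≤i₂ , i₂<m , xyⁱ² = E-between i₁≤τ τ≤i₂ i₂<m xyⁱ¹ xyⁱ²

      -- At τ = t + 1, the order that ranks {a , b} and {u , v} as the majority
      -- does and every other pair as E (t + 1).
      square : Dec (M a b) → Dec (M v u) → Order n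
      square (yes _) (yes _) = R′
      square (yes _) (no _) = E t
      square (no _) (yes _) = E (suc (suc t))
      square (no _) (no _) = E (suc t)

      square-unique : ∀ dab dvu → Unique (square dab dvu)
      square-unique (yes _) (yes _) = R′-unique
      square-unique (yes _) (no _) = Eₜ-unique
      square-unique (no _) (yes _) = Eₜ₊₂-unique
      square-unique (no _) (no _) = Eₜ₊₁-unique

      square-other : ∀ dab dvu {x y} → Other x y → Above (E (suc t)) x y → Above (square dab dvu) x y
      square-other (yes _) (yes _) other = Eₜ₊₁⇒R′ other
      square-other (yes _) (no _) other = S₁.reflects (proj₁ other)
      square-other (no _) (yes _) other = S₂.keeps (proj₂ other)
      square-other (no _) (no _) _ xy = xy

      majority-in-square : (∀ {x y} → Other x y → M x y → Above (E (suc t)) x y) →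
        ∀ dab dvu x y → M x y → Above (square dab dvu) x y
      majority-in-square others dab dvu x y mxy with samePair? a b x y | samePair? u v x y
      ... | yes (inj₁ (refl , refl)) | _ = ab dab dvu
        where
        ab : ∀ dab dvu → Above (square dab dvu) a b
        ab (no ¬mab) _ = ⊥-elim (¬mab mxy)
        ab (yes _) (yes _) = abᴿ
        ab (yes _) (no _) = S₁.upper-above
      ... | yes (inj₂ (refl , refl)) | _ = ba dab dvu
        where
        ba : ∀ dab dvu → Above (square dab dvu) b a
        ba (yes mab) _ = ⊥-elim (M-asym mab mxy)
        ba (no _) (yes _) = S₂.keeps (not-uv (λ b≡u → u≢b (sym b≡u)) (λ b≡v → v≢b (sym b≡v))) S₁.lower-above
        ba (no _) (no _) = S₁.lower-above
      ... | no _ | yes (inj₁ (refl , refl)) = uv dab dvu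
        where
        uv : ∀ dab dvu → Above (square dab dvu) u v
        uv _ (yes mvu) = ⊥-elim (M-asym mxy mvu)
        uv (yes _) (no _) = Consec⇒Above Eₜ-unique uv-adjacent
        uv (no _) (no _) = S₂.upper-above
      ... | no _ | yes (inj₂ (refl , refl)) = vu dab dvu
        where
        vu : ∀ dab dvu → Above (square dab dvu) v u
        vu _ (no ¬mvu) = ⊥-elim (¬mvu mxy)
        vu (yes _) (yes _) = vuᴿ
        vu (no _) (yes _) = S₂.lower-above
      ... | no not-ab | no not-uv = square-other dab dvu (not-ab , not-uv) (others (not-ab , not-uv) mxy)

      -- The majority relation lies within E τ for the median index τ, or within
      -- the square order when τ = t + 1.
      profile-acyclic : 0 < k → Acyclic M
      profile-acyclic 0<k with median-voter k pos 0<k pos<m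
      ... | τ , τ<m , median with τ ≟ suc t
      ...   | no τ≢t+1 = Acyclic-within (E τ) (E-unique τ<m) (λ x y → majority-at-median median (inj₁ τ≢t+1))
      ...   | yes refl = Acyclic-within (square (M? a b) (M? v u)) (square-unique (M? a b) (M? v u))
                           (majority-in-square (λ other → majority-at-median median (inj₂ other)) (M? a b) (M? v u))

    D⁺-condorcet : IsCondorcet D⁺
    D⁺-condorcet = D⁺-domain , acyclic
      where
      acyclic : ∀ k (P : Fin k → Order n) → (∀ w → D⁺ (P w)) → Acyclic (Majority k P)
      acyclic zero P _ = Acyclic-within [] [] (λ _ _ ())
      acyclic (suc k) P inD⁺ = Profile.profile-acyclic P inD⁺ (s≤s z≤n)

    disjoint-steps-absurd : ⊥
    disjoint-steps-absurd with E-onto R′ (maximalᶜ D⁺ D⁺-condorcet (λ _ → inj₁) R′ (inj₂ refl))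
    ... | l , l<m , Eₗ≡R′ = R′-new l l<m Eₗ≡R′

  steps-share : ∃ λ z → (z ≡ a ⊎ z ≡ b) × (z ≡ u ⊎ z ≡ v)
  steps-share with u ≟ᶠ a | u ≟ᶠ b | v ≟ᶠ a | v ≟ᶠ b
  ... | yes u≡a | _ | _ | _ = a , inj₁ refl , inj₁ (sym u≡a)
  ... | _ | yes u≡b | _ | _ = b , inj₂ refl , inj₁ (sym u≡b)
  ... | _ | _ | yes v≡a | _ = a , inj₁ refl , inj₂ (sym v≡a)
  ... | _ | _ | _ | yes v≡b = b , inj₂ refl , inj₂ (sym v≡b)
  ... | no u≢a | no u≢b | no v≢a | no v≢b = ⊥-elim (disjoint-steps-absurd u≢a u≢b v≢a v≢b)

theorem9 : ∀ (n : ℕ) (D : Domain n) → IsMaximalSingleCrossing D →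
    ∀ (m : ℕ) (e : Fin m → Order n) → IsSCEnumeration D m e →
    (IsMaximalCondorcet D ⇔ PairwiseConcatenation m e)
theorem9 n D ((isD , _) , maximal) m e sc = mk⇔ necessity sufficiency
  where
  open MaximalChain D isD m e sc maximal using (concatenated⇔)
  open ConcatenationSuffices D isD m e sc maximal using (concatenated⇒maximal)

  necessity : IsMaximalCondorcet D → PairwiseConcatenation m e
  necessity (_ , maximalᶜ) =
    Equivalence.from concatenated⇔ (ConcatenationNecessary.steps-share D isD m e sc maximal maximalᶜ)

  sufficiency : PairwiseConcatenation m e → IsMaximalCondorcet D
  sufficiency pc = concatenated⇒maximal (Equivalence.to concatenated⇔ pc)
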